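{- Let $N\in\mathbb N$ and $y\in\Gamma_N$. Then the group $G=\langle R,s\rangle\subset GL_3(\mathbb R)$ stabilises $X_{N,y}(\mathbb Z)$: for every $P\in X_{N,y}(\mathbb Z)$, its orbit $\{gP:g\in G\}$ is contained in $X_{N,y}(\mathbb Z)$.
   Context: $R=\frac12\begin{pmatrix}1&0&-3\\0&2&0\\1&0&1\end{pmatrix}$ and $s(x,y,z)=(x,y,-z)$. $X_{N,y}(\mathbb Z)=\{(x,y',z)\in\mathbb Z^3:x^2+2y'^2+3z^2=48N+30,\ y'=y\}$. $I_N$ is the set of odd integers in $]-\sqrt{15+24N},\sqrt{15+24N}[$. For $y\in I_N$ write $y^2=3p$ or $y^2=3p+1$ ($p\in\mathbb Z$), set $M_y=16N+10-2p$, $\mathcal I_{N,y}=\{m\in\mathbb Z:|m|\le\lfloor\sqrt{48N+30-2y^2}\rfloor\}$, $\Omega_{N,y}(0)=\{m\in\mathcal I_{N,y}: m^2\equiv0 \ (3),\ M_y-m^2/3\text{ a perfect square}\}$, $\Omega_{N,y}(1)=\{m\in\mathcal I_{N,y}: m^2\equiv1\ (3),\ M_y-(m^2+2)/3\text{ a perfect square}\}$, and $\Gamma_N=\{y\in I_N:\Omega_{N,y}(0)\neq\emptyset\text{ or }\Omega_{N,y}(1)\neq\emptyset\}$. -}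

module Defs where

open import Data.Nat as ℕ using (ℕ)
open import Data.Integer as ℤ using (ℤ; +_; ∣_∣)
open import Data.Rational as ℚ using (ℚ; _/_)
open import Data.Fin using (Fin; zero; suc)
open import Data.List using (List; []; _∷_)
open import Data.Product using (_×_; _,_; Σ; ∃)
open import Data.Sum using (_⊎_)
open import Relation.Binary.PropositionalEquality using (_≡_)

Vec3 : Set
Vec3 = Fin 3 → ℚ

Mat3 : Set
Mat3 = Fin 3 → Fin 3 → ℚ

_·_ : Mat3 → Vec3 → Vec3
(A · v) i = A i zero ℚ.* v zero ℚ.+ A i (suc zero) ℚ.* v (suc zero)
            ℚ.+ A i (suc (suc zero)) ℚ.* v (suc (suc zero))

mat : ℚ → ℚ → ℚ → ℚ → ℚ → ℚ → ℚ → ℚ → ℚ → Mat3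
mat a b c d e f g h i zero zero = a
mat a b c d e f g h i zero (suc zero) = b
mat a b c d e f g h i zero (suc (suc zero)) = c
mat a b c d e f g h i (suc zero) zero = d
mat a b c d e f g h i (suc zero) (suc zero) = e
mat a b c d e f g h i (suc zero) (suc (suc zero)) = f
mat a b c d e f g h i (suc (suc zero)) zero = g
mat a b c d e f g h i (suc (suc zero)) (suc zero) = h
mat a b c d e f g h i (suc (suc zero)) (suc (suc zero)) = i

Rm : Mat3
Rm = mat (+ 1 / 2) (+ 0 / 1) (ℤ.- (+ 3) / 2)
         (+ 0 / 1) (+ 1 / 1) (+ 0 / 1)
         (+ 1 / 2) (+ 0 / 1) (+ 1 / 2)

Rinvm : Mat3
Rinvm = mat (+ 1 / 2) (+ 0 / 1) (+ 3 / 2)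
            (+ 0 / 1) (+ 1 / 1) (+ 0 / 1)
            (ℤ.- (+ 1) / 2) (+ 0 / 1) (+ 1 / 2)

-- s(x,y,z) = (x,y,-z)   (s is an involution, s⁻¹ = s)
sm : Mat3
sm = mat (+ 1 / 1) (+ 0 / 1) (+ 0 / 1)
         (+ 0 / 1) (+ 1 / 1) (+ 0 / 1)
         (+ 0 / 1) (+ 0 / 1) (ℤ.- (+ 1) / 1)

data Gen : Set where
  R R⁻¹ s : Gen

genMat : Gen → Mat3
genMat R   = Rm
genMat R⁻¹ = Rinvm
genMat s   = sm

-- An element of G is a word g₁ g₂ … gₖ in the generators and their inverses;
-- it acts by the matrix product g₁ g₂ … gₖ (the empty word is the identity).
G : Set
G = List Gen

act : G → Vec3 → Vec3
act []      v = v
act (g ∷ w) v = genMat g · act w v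

Point : Set
Point = ℤ × ℤ × ℤ

embed : Point → Vec3
embed (x , y , z) zero = x / 1
embed (x , y , z) (suc zero) = y / 1
embed (x , y , z) (suc (suc zero)) = z / 1

InX : ℕ → ℤ → Point → Set
InX N y (x , y' , z) =
  (x ℤ.* x ℤ.+ + 2 ℤ.* (y' ℤ.* y') ℤ.+ + 3 ℤ.* (z ℤ.* z) ≡ + (48 ℕ.* N ℕ.+ 30))
  × y' ≡ y

Odd : ℤ → Set
Odd y = ∃ λ k → y ≡ + 2 ℤ.* k ℤ.+ + 1

-- y ∈ I_N :  y odd and -√(15+24N) < y < √(15+24N), i.e. y² < 15+24N
InI : ℕ → ℤ → Set
InI N y = Odd y × (∣ y ∣ ℕ.* ∣ y ∣ ℕ.< 15 ℕ.+ 24 ℕ.* N)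

-- p with y² = 3p or y² = 3p+1
pOf : ℤ → ℕ
pOf y = (∣ y ∣ ℕ.* ∣ y ∣) ℕ./ 3

M : ℕ → ℤ → ℤ
M N y = + (16 ℕ.* N ℕ.+ 10) ℤ.- + (2 ℕ.* pOf y)

-- m ∈ 𝓘_{N,y} : |m| ≤ ⌊√(48N+30-2y²)⌋, i.e. m² ≤ 48N+30-2y²
InIcal : ℕ → ℤ → ℤ → Set
InIcal N y m = + (∣ m ∣ ℕ.* ∣ m ∣) ℤ.≤ + (48 ℕ.* N ℕ.+ 30) ℤ.- + 2 ℤ.* (y ℤ.* y)

IsSquare : ℤ → Set
IsSquare a = ∃ λ (k : ℕ) → + (k ℕ.* k) ≡ a

InΩ0 : ℕ → ℤ → ℤ → Set
InΩ0 N y m = InIcal N y m × ((∣ m ∣ ℕ.* ∣ m ∣) ℕ.% 3 ≡ 0)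
             × IsSquare (M N y ℤ.- + ((∣ m ∣ ℕ.* ∣ m ∣) ℕ./ 3))

InΩ1 : ℕ → ℤ → ℤ → Set
InΩ1 N y m = InIcal N y m × ((∣ m ∣ ℕ.* ∣ m ∣) ℕ.% 3 ≡ 1)
             × IsSquare (M N y ℤ.- + ((∣ m ∣ ℕ.* ∣ m ∣ ℕ.+ 2) ℕ./ 3))

InΓ : ℕ → ℤ → Set
InΓ N y = InI N y × ((∃ λ m → InΩ0 N y m) ⊎ (∃ λ m → InΩ1 N y m))

-- Where x² + 2y² + 3z² is even, x and z have the same parity, so writing x = z + 2d the
-- halves in R and R⁻¹ cancel: R(z + 2d, y, z) = (d − z, y, d + z) and
-- R⁻¹(z + 2d, y, z) = (2z + d, y, −d) are again integer points. Both maps, and s, preserve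
-- the form x² + 2y² + 3z² and the middle coordinate, so every word in R, R⁻¹, s keeps an
-- integer point of X_{N,y} inside X_{N,y}.
module Submission where

open import Defs
open import Data.Nat using (ℕ)
open import Data.Integer using (ℤ)
open import Data.Product using (Σ; _×_)
open import Data.Fin using (Fin)
open import Relation.Binary.PropositionalEquality using (_≡_)

import Data.Nat as ℕ
open import Data.Nat.Divisibility using () renaming (_∣_ to _∣ℕ_; divides to dividesℕ)
open import Data.Nat.Primality using (prime[2]; euclidsLemma)
import Data.Nat.Tactic.RingSolver as ℕ-Solver
open import Data.Integer using (+_; _+_; _*_; _-_; -_; ∣_∣)
open import Data.Integer.Properties using (abs-*; *-comm)
open import Data.Integer.Divisibility.Signed
  using (_∣_; divides; ∣ᵤ⇒∣; ∣⇒∣ᵤ; ∣-refl; ∣m∣n⇒∣m-n; ∣n⇒∣m*n)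
open import Data.Integer.Tactic.RingSolver using (solve)
import Data.Rational as ℚ
open import Data.Rational using (_/_; toℚᵘ)
open import Data.Rational.Properties
  using (toℚᵘ-injective; toℚᵘ-fromℚᵘ; toℚᵘ-homo-+; toℚᵘ-homo-*)
import Data.Rational.Unnormalised as ℚᵘ
open import Data.Rational.Unnormalised using (_≃_; *≡*) renaming (_/_ to _/ᵘ_)
import Data.Rational.Unnormalised.Properties as ℚᵘ
open import Data.Fin using (zero; suc)
open import Data.List using ([]; _∷_)
open import Data.Product using (_,_; ∃)
open import Data.Sum using ([_,_]′)
open import Function using (_∘_; _∋_)
open import Relation.Binary.PropositionalEquality
  using (refl; sym; trans; cong; subst; module ≡-Reasoning)

toℚᵘ-/ : ∀ i k → toℚᵘ (i / ℕ.suc k) ≃ i /ᵘ ℕ.suc k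
toℚᵘ-/ i k = toℚᵘ-fromℚᵘ (i /ᵘ ℕ.suc k)

halfRow-ℚᵘ : ∀ a b c x y z q → + 2 * q ≡ a * x + b * y + c * z →
  (a /ᵘ 2) ℚᵘ.* (x /ᵘ 1) ℚᵘ.+ (b /ᵘ 2) ℚᵘ.* (y /ᵘ 1) ℚᵘ.+ (c /ᵘ 2) ℚᵘ.* (z /ᵘ 1) ≃ q /ᵘ 1
halfRow-ℚᵘ a b c x y z q 2q≡row = *≡* (begin
    ((a * x * + 2 + b * y * + 2) * + 2 + c * z * + 4) * + 1 ≡⟨ solve (a ∷ b ∷ c ∷ x ∷ y ∷ z ∷ []) ⟩
    (a * x + b * y + c * z) * + 4                           ≡⟨ cong (_* + 4) 2q≡row ⟨
    + 2 * q * + 4                                           ≡⟨ solve (q ∷ []) ⟩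
    q * + 8                                                 ∎)
  where open ≡-Reasoning

toℚᵘ-halfRow : ∀ a b c x y z →
  toℚᵘ ((a / 2) ℚ.* (x / 1) ℚ.+ (b / 2) ℚ.* (y / 1) ℚ.+ (c / 2) ℚ.* (z / 1))
    ≃ (a /ᵘ 2) ℚᵘ.* (x /ᵘ 1) ℚᵘ.+ (b /ᵘ 2) ℚᵘ.* (y /ᵘ 1) ℚᵘ.+ (c /ᵘ 2) ℚᵘ.* (z /ᵘ 1)
toℚᵘ-halfRow a b c x y z = begin
  toℚᵘ (ax ℚ.+ by ℚ.+ cz)               ≈⟨ toℚᵘ-homo-+ (ax ℚ.+ by) cz ⟩
  toℚᵘ (ax ℚ.+ by) ℚᵘ.+ toℚᵘ cz         ≈⟨ ℚᵘ.+-congˡ (toℚᵘ cz) (toℚᵘ-homo-+ ax by) ⟩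
  toℚᵘ ax ℚᵘ.+ toℚᵘ by ℚᵘ.+ toℚᵘ cz     ≈⟨ ℚᵘ.+-cong (ℚᵘ.+-cong (term a x) (term b y)) (term c z) ⟩
  (a /ᵘ 2) ℚᵘ.* (x /ᵘ 1) ℚᵘ.+ (b /ᵘ 2) ℚᵘ.* (y /ᵘ 1) ℚᵘ.+ (c /ᵘ 2) ℚᵘ.* (z /ᵘ 1) ∎
  where
  open ℚᵘ.≃-Reasoning
  ax = (a / 2) ℚ.* (x / 1)
  by = (b / 2) ℚ.* (y / 1)
  cz = (c / 2) ℚ.* (z / 1)
  term : ∀ a x → toℚᵘ ((a / 2) ℚ.* (x / 1)) ≃ (a /ᵘ 2) ℚᵘ.* (x /ᵘ 1)
  term a x = ℚᵘ.≃-trans (toℚᵘ-homo-* (a / 2) (x / 1)) (ℚᵘ.*-cong (toℚᵘ-/ a 1) (toℚᵘ-/ x 0))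

-- Rows with entries in ℤ are covered too, since
-- e.g. + 2 / 2 and + 1 / 1 are the same normalised rational.
halfRow : ∀ a b c x y z q → + 2 * q ≡ a * x + b * y + c * z →
  (a / 2) ℚ.* (x / 1) ℚ.+ (b / 2) ℚ.* (y / 1) ℚ.+ (c / 2) ℚ.* (z / 1) ≡ q / 1
halfRow a b c x y z q 2q≡row = toℚᵘ-injective (begin
  toℚᵘ (ax ℚ.+ by ℚ.+ cz)                                   ≈⟨ toℚᵘ-halfRow a b c x y z ⟩
  (a /ᵘ 2) ℚᵘ.* (x /ᵘ 1) ℚᵘ.+ (b /ᵘ 2) ℚᵘ.* (y /ᵘ 1)
    ℚᵘ.+ (c /ᵘ 2) ℚᵘ.* (z /ᵘ 1)                             ≈⟨ halfRow-ℚᵘ a b c x y z q 2q≡row ⟩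
  q /ᵘ 1                                                    ≈⟨ toℚᵘ-/ q 0 ⟨
  toℚᵘ (q / 1)                                              ∎)
  where
  open ℚᵘ.≃-Reasoning
  ax = (a / 2) ℚ.* (x / 1)
  by = (b / 2) ℚ.* (y / 1)
  cz = (c / 2) ℚ.* (z / 1)

form : Point → ℤ
form (x , y , z) = x * x + + 2 * (y * y) + + 3 * (z * z)

Level : ℤ → ℤ → Point → Set
Level n y (x , y′ , z) = form (x , y′ , z) ≡ n × y′ ≡ y

2∣n*n⇒2∣n : ∀ n → + 2 ∣ n * n → + 2 ∣ n
2∣n*n⇒2∣n n 2∣n*n = [ ∣ᵤ⇒∣ , ∣ᵤ⇒∣ ]′
  (euclidsLemma ∣ n ∣ ∣ n ∣ prime[2] (subst (2 ∣ℕ_) (abs-* n n) (∣⇒∣ᵤ 2∣n*n)))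

2∣form⇒2∣x-z : ∀ x y z → + 2 ∣ form (x , y , z) → + 2 ∣ x - z
2∣form⇒2∣x-z x y z 2∣form = 2∣n*n⇒2∣n (x - z) (subst (+ 2 ∣_) (sym square-of-difference)
  (∣m∣n⇒∣m-n 2∣form (∣n⇒∣m*n (y * y + z * (x + z)) ∣-refl)))
  where
  square-of-difference :
    (x - z) * (x - z) ≡ x * x + + 2 * (y * y) + + 3 * (z * z) - (y * y + z * (x + z)) * + 2
  square-of-difference = solve (x ∷ y ∷ z ∷ [])

2∣form⇒x≡z+2d : ∀ x y z → + 2 ∣ form (x , y , z) → ∃ λ d → x ≡ z + + 2 * d
2∣form⇒x≡z+2d x y z 2∣form = x≡z+2d (2∣form⇒2∣x-z x y z 2∣form)
  where
  open ≡-Reasoning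
  x≡z+2d : + 2 ∣ x - z → ∃ λ d → x ≡ z + + 2 * d
  x≡z+2d (divides d x-z≡d*2) = d , (begin
    x             ≡⟨ solve (x ∷ z ∷ []) ⟩
    z + (x - z)   ≡⟨ cong (λ t → z + t) x-z≡d*2 ⟩
    z + d * + 2   ≡⟨ cong (λ t → z + t) (*-comm d (+ 2)) ⟩
    z + + 2 * d   ∎)

image : Gen → ℤ → ℤ → ℤ → Point
image R   d y z = (d - z , y , d + z)
image R⁻¹ d y z = (+ 2 * z + d , y , - d)
image s   d y z = (z + + 2 * d , y , - z)

IsImage : (Vec3 → Vec3) → Point → Point → Set
IsImage f P Q = ∀ i → embed Q i ≡ f (embed P) i

image-isImage : ∀ g d y z → IsImage (genMat g ·_) (z + + 2 * d , y , z) (image g d y z)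
image-isImage g d y z = coordinate g
  where
  row : ∀ a b c q → + 2 * q ≡ a * (z + + 2 * d) + b * y + c * z →
        q / 1 ≡ (a / 2) ℚ.* ((z + + 2 * d) / 1) ℚ.+ (b / 2) ℚ.* (y / 1) ℚ.+ (c / 2) ℚ.* (z / 1)
  row a b c q = sym ∘ halfRow a b c (z + + 2 * d) y z q
  coordinate : ∀ g → IsImage (genMat g ·_) (z + + 2 * d , y , z) (image g d y z)
  coordinate R   zero             = row (+ 1) (+ 0) (- + 3) (d - z) (solve (d ∷ y ∷ z ∷ []))
  coordinate R   (suc zero)       = row (+ 0) (+ 2) (+ 0)   y (solve (d ∷ y ∷ z ∷ []))
  coordinate R   (suc (suc zero)) = row (+ 1) (+ 0) (+ 1)   (d + z) (solve (d ∷ y ∷ z ∷ []))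
  coordinate R⁻¹ zero             = row (+ 1) (+ 0) (+ 3)   (+ 2 * z + d) (solve (d ∷ y ∷ z ∷ []))
  coordinate R⁻¹ (suc zero)       = row (+ 0) (+ 2) (+ 0)   y (solve (d ∷ y ∷ z ∷ []))
  coordinate R⁻¹ (suc (suc zero)) = row (- + 1) (+ 0) (+ 1) (- d) (solve (d ∷ y ∷ z ∷ []))
  coordinate s   zero             = row (+ 2) (+ 0) (+ 0)   (z + + 2 * d) (solve (d ∷ y ∷ z ∷ []))
  coordinate s   (suc zero)       = row (+ 0) (+ 2) (+ 0)   y (solve (d ∷ y ∷ z ∷ []))
  coordinate s   (suc (suc zero)) = row (+ 0) (+ 0) (- + 2) (- z) (solve (d ∷ y ∷ z ∷ []))

image-form : ∀ g d y z → form (image g d y z) ≡ form (z + + 2 * d , y , z)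
image-form R d y z =
  (d - z) * (d - z) + + 2 * (y * y) + + 3 * ((d + z) * (d + z))
    ≡ (z + + 2 * d) * (z + + 2 * d) + + 2 * (y * y) + + 3 * (z * z)
  ∋ solve (d ∷ y ∷ z ∷ [])
image-form R⁻¹ d y z =
  (+ 2 * z + d) * (+ 2 * z + d) + + 2 * (y * y) + + 3 * ((- d) * (- d))
    ≡ (z + + 2 * d) * (z + + 2 * d) + + 2 * (y * y) + + 3 * (z * z)
  ∋ solve (d ∷ y ∷ z ∷ [])
image-form s d y z =
  (z + + 2 * d) * (z + + 2 * d) + + 2 * (y * y) + + 3 * ((- z) * (- z))
    ≡ (z + + 2 * d) * (z + + 2 * d) + + 2 * (y * y) + + 3 * (z * z)
  ∋ solve (d ∷ y ∷ z ∷ [])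

image-level : ∀ {n} g d y z → form (z + + 2 * d , y , z) ≡ n → Level n y (image g d y z)
image-level R   d y z form≡n = trans (image-form R d y z) form≡n , refl
image-level R⁻¹ d y z form≡n = trans (image-form R⁻¹ d y z) form≡n , refl
image-level s   d y z form≡n = trans (image-form s d y z) form≡n , refl

generator-step : ∀ {n y} → + 2 ∣ n → ∀ g P → Level n y P →
                 Σ Point λ Q → IsImage (genMat g ·_) P Q × Level n y Q
generator-step {n} 2∣n g (x , y , z) (form≡n , refl) =
  step (2∣form⇒x≡z+2d x y z (subst (+ 2 ∣_) (sym form≡n) 2∣n)) form≡n
  where
  step : (∃ λ d → x ≡ z + + 2 * d) → form (x , y , z) ≡ n →
         Σ Point λ Q → IsImage (genMat g ·_) (x , y , z) Q × Level n y Q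
  step (d , refl) form≡n′ = image g d y z , image-isImage g d y z , image-level g d y z form≡n′

·-cong : ∀ A {u v : Vec3} → (∀ i → u i ≡ v i) → ∀ i → (A · u) i ≡ (A · v) i
·-cong A u≗v i rewrite u≗v zero | u≗v (suc zero) | u≗v (suc (suc zero)) = refl

orbit-level : ∀ {n y} → + 2 ∣ n → ∀ P → Level n y P →
              ∀ w → Σ Point λ Q → IsImage (act w) P Q × Level n y Q
orbit-level 2∣n P P∈L [] = P , (λ _ → refl) , P∈L
orbit-level 2∣n P P∈L (g ∷ w) with orbit-level 2∣n P P∈L w
... | Q , wP=Q , Q∈L with generator-step 2∣n g Q Q∈L
... | Q′ , gQ=Q′ , Q′∈L = Q′ , (λ i → trans (gQ=Q′ i) (·-cong (genMat g) wP=Q i)) , Q′∈L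

2∣48N+30 : ∀ N → + 2 ∣ + (48 ℕ.* N ℕ.+ 30)
2∣48N+30 N = ∣ᵤ⇒∣ (dividesℕ (24 ℕ.* N ℕ.+ 15)
  (48 ℕ.* N ℕ.+ 30 ≡ (24 ℕ.* N ℕ.+ 15) ℕ.* 2 ∋ ℕ-Solver.solve (N ∷ [])))

proposition8p41 : (N : ℕ) (y : ℤ) → InΓ N y →
    (P : Point) → InX N y P →
    (g : G) → Σ Point (λ Q → ((i : Fin 3) → embed Q i ≡ act g (embed P) i) × InX N y Q)
proposition8p41 N y _ = orbit-level (2∣48N+30 N)
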